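{- Let $V_1$ and $V_2$ be disjoint finite sets of nails. Let $f_1$ be a specification on $V_1$ and $h_1$ an expression in the variables of $V_1$ that solves $f_1$; let $f_2$ be a specification on $V_2$ and $h_2$ an expression in the variables of $V_2$ that solves $f_2$. Regard $f_1,f_2$ as specifications on $V_1 \cup V_2$ via $f_i(S) := f_i(S \cap V_i)$. Then, over $V_1 \cup V_2$, the expression $h_1 + h_2$ solves $f_1 \wedge f_2$, and the commutator $[h_1,h_2]$ solves $f_1 \vee f_2$.
   Context: Expressions are elements of the free group on a set of variables (nails), written additively: $+$ is the non-commutative group operation, $-x$ the inverse, $0$ the identity. The commutator is $[a,b] = a + b - a - b$. For a set $S$ of nails, $h|_S$ denotes $h$ with every variable in $S$ set to $0$. A specification on a finite nail set $V$ is a monotone function $f : 2^V \to \{\mathsf{hang},\mathsf{fall}\}$ (with order $\mathsf{hang} < \mathsf{fall}$, monotone meaning $S \subseteq S' \Rightarrow f(S) \le f(S')$) satisfying $f(V) = \mathsf{fall}$. An expression $h$ on $V$ solves $f$ if for every $S \subseteq V$: $h|_S = 0 \iff f(S) = \mathsf{fall}$. The operations $\vee,\wedge$ on specifications are pointwise max and min for the order $\mathsf{hang} < \mathsf{fall}$. -}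

module Defs where

open import Data.Bool using (Bool; true; false; not)
open import Data.List using (List; []; _∷_; _++_; map; reverse; concatMap)
open import Data.Product using (_×_; _,_)
open import Data.Sum using (_⊎_; inj₁; inj₂)
open import Data.Fin using (Fin)
open import Data.Nat using (ℕ)
open import Function.Bundles using (_⇔_)
open import Relation.Binary.PropositionalEquality using (_≡_)

-- Expressions: elements of the free group on a set V of nails.
-- Represented by words: a letter (true , x) is x, (false , x) is -x.
Letter : Set → Set
Letter V = Bool × V

Word : Set → Set
Word V = List (Letter V)

infix 4 _≈_
data _≈_ {V : Set} : Word V → Word V → Set where
  ≈-refl   : ∀ {w} → w ≈ w
  ≈-sym    : ∀ {w w'} → w ≈ w' → w' ≈ w
  ≈-trans  : ∀ {u v w} → u ≈ v → v ≈ w → u ≈ w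
  ≈-cancel : ∀ (u w : Word V) (b : Bool) (x : V) →
             (u ++ ((b , x) ∷ (not b , x) ∷ w)) ≈ (u ++ w)

0ₑ : ∀ {V} → Word V
0ₑ = []

infixl 6 _+ₑ_
_+ₑ_ : ∀ {V} → Word V → Word V → Word V
a +ₑ b = a ++ b

-ₑ_ : ∀ {V} → Word V → Word V
-ₑ a = reverse (map (λ { (b , x) → (not b , x) }) a)

[_,_]ₑ : ∀ {V} → Word V → Word V → Word V
[ a , b ]ₑ = a +ₑ b +ₑ (-ₑ a) +ₑ (-ₑ b)

Subset : Set → Set
Subset V = V → Bool

_⊆_ : ∀ {V} → Subset V → Subset V → Set
S ⊆ S' = ∀ x → S x ≡ true → S' x ≡ true

full : ∀ {V} → Subset V
full _ = true

-- h|_S : set every variable in S to 0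
restrict : ∀ {V} → Word V → Subset V → Word V
restrict h S = concatMap (λ { (b , x) → if' (S x) (b , x) }) h
  where
  if' : ∀ {V} → Bool → Letter V → Word V
  if' true  _ = []
  if' false l = l ∷ []

data Outcome : Set where
  hang fall : Outcome

data _≤ₒ_ : Outcome → Outcome → Set where
  hang≤ : ∀ {o} → hang ≤ₒ o
  fall≤fall : fall ≤ₒ fall

_⊔ₒ_ : Outcome → Outcome → Outcome
hang ⊔ₒ o = o
fall ⊔ₒ _ = fall

_⊓ₒ_ : Outcome → Outcome → Outcome
hang ⊓ₒ _ = hang
fall ⊓ₒ o = o

record Specification (V : Set) : Set where
  field
    spec     : Subset V → Outcome
    monotone : ∀ {S S'} → S ⊆ S' → spec S ≤ₒ spec S'
    full-falls : spec full ≡ fall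
open Specification public

Solves : ∀ {V} → Word V → (Subset V → Outcome) → Set
Solves h f = ∀ (S : Subset _) → (restrict h S ≈ 0ₑ) ⇔ (f S ≡ fall)

_∨ₛ_ : ∀ {V} → (Subset V → Outcome) → (Subset V → Outcome) → Subset V → Outcome
(f ∨ₛ g) S = f S ⊔ₒ g S

_∧ₛ_ : ∀ {V} → (Subset V → Outcome) → (Subset V → Outcome) → Subset V → Outcome
(f ∧ₛ g) S = f S ⊓ₒ g S

embed₁ : ∀ {V₁ V₂} → Word V₁ → Word (V₁ ⊎ V₂)
embed₁ = map (λ { (b , x) → (b , inj₁ x) })

embed₂ : ∀ {V₁ V₂} → Word V₂ → Word (V₁ ⊎ V₂)
embed₂ = map (λ { (b , x) → (b , inj₂ x) })

lift₁ : ∀ {V₁ V₂} → Specification V₁ → Subset (V₁ ⊎ V₂) → Outcome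
lift₁ f S = spec f (λ x → S (inj₁ x))

lift₂ : ∀ {V₁ V₂} → Specification V₂ → Subset (V₁ ⊎ V₂) → Outcome
lift₂ f S = spec f (λ x → S (inj₂ x))

-- Restricting variables is a group homomorphism that commutes with the embeddings of F(V₁) and
-- F(V₂) into F(V₁ ⊎ V₂), so both claims reduce to facts about a ∈ F(V₁), b ∈ F(V₂): a + b = 0 iff
-- a = b = 0, and [a, b] = 0 iff a = 0 or b = 0. Both follow from reduced words: if a and b are
-- nontrivial, their reduced forms (and those of -a and -b) are nonempty words over disjoint
-- alphabets, and concatenating them alternately gives a nonempty reduced word, which is nonzero
-- because the normal form map is invariant under cancellation.
module Submission where

open import Defs
open import Data.Nat using (ℕ)
open import Data.Fin using (Fin)
open import Data.Product using (_×_)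
open import Data.Sum using (_⊎_)

open import Data.Bool using (Bool; true; false; not)
import Data.Bool.Properties as Bool
open import Data.Empty using (⊥-elim)
import Data.Fin.Properties as Fin
open import Data.List using (List; []; _∷_; _++_; map; reverse; foldr)
open import Data.List.Properties using (++-assoc; ++-identityʳ; map-++; foldr-++; concatMap-++; unfold-reverse; reverse-map; map-∘)
open import Data.List.Relation.Unary.All using (All; []; _∷_)
open import Data.Product using (∃₂; _,_; proj₁; proj₂; map₁; map₂)
open import Data.Product.Function.NonDependent.Propositional using (_×-⇔_)
import Data.Product.Properties as Product
open import Data.Sum using (inj₁; inj₂; [_,_]′)
open import Data.Sum.Function.Propositional using (_⊎-⇔_)
import Data.Sum.Properties as Sum
open import Function using (_∘_)
open import Function.Bundles using (_⇔_; mk⇔)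
open import Function.Definitions using (Injective)
import Function.Properties.Equivalence as ⇔
open import Relation.Binary.Bundles using (Setoid)
open import Relation.Binary.Definitions using (DecidableEquality)
open import Relation.Binary.PropositionalEquality using (_≡_; _≢_; refl; sym; trans; cong; cong₂; subst; module ≡-Reasoning)
open import Relation.Nullary using (¬_; yes; no)

private
  variable
    A B V W : Set
    l l′ : Letter V
    u v w : Word V

inv : Letter V → Letter V
inv = map₁ not

inv-involutive : (l : Letter V) → inv (inv l) ≡ l
inv-involutive l = cong (_, proj₂ l) (Bool.not-involutive (proj₁ l))

-ₑ-∷ : (l : Letter V) (u : Word V) → -ₑ (l ∷ u) ≡ -ₑ u ++ inv l ∷ []
-ₑ-∷ l u = unfold-reverse (inv l) (map inv u)

≡⇒≈ : u ≡ v → u ≈ v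
≡⇒≈ refl = ≈-refl

≈-setoid : Set → Setoid _ _
≈-setoid V = record
  { Carrier = Word V
  ; _≈_ = _≈_
  ; isEquivalence = record { refl = ≈-refl ; sym = ≈-sym ; trans = ≈-trans }
  }

module ≈-Reasoning {V : Set} where
  open import Relation.Binary.Reasoning.Setoid (≈-setoid V) public

inv-cancel : (u w : Word V) (l : Letter V) → u ++ l ∷ inv l ∷ w ≈ u ++ w
inv-cancel u w l = ≈-cancel u w (proj₁ l) (proj₂ l)

++-congˡ : (p : Word V) → u ≈ v → p ++ u ≈ p ++ v
++-congˡ p ≈-refl = ≈-refl
++-congˡ p (≈-sym e) = ≈-sym (++-congˡ p e)
++-congˡ p (≈-trans e e′) = ≈-trans (++-congˡ p e) (++-congˡ p e′)
++-congˡ p (≈-cancel u w b x) = begin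
  p ++ u ++ (b , x) ∷ (not b , x) ∷ w   ≡⟨ ++-assoc p u _ ⟨
  (p ++ u) ++ (b , x) ∷ (not b , x) ∷ w ≈⟨ ≈-cancel (p ++ u) w b x ⟩
  (p ++ u) ++ w                         ≡⟨ ++-assoc p u w ⟩
  p ++ u ++ w                           ∎
  where open ≈-Reasoning

++-congʳ : (q : Word V) → u ≈ v → u ++ q ≈ v ++ q
++-congʳ q ≈-refl = ≈-refl
++-congʳ q (≈-sym e) = ≈-sym (++-congʳ q e)
++-congʳ q (≈-trans e e′) = ≈-trans (++-congʳ q e) (++-congʳ q e′)
++-congʳ q (≈-cancel u w b x) = begin
  (u ++ (b , x) ∷ (not b , x) ∷ w) ++ q ≡⟨ ++-assoc u _ q ⟩
  u ++ (b , x) ∷ (not b , x) ∷ w ++ q   ≈⟨ ≈-cancel u (w ++ q) b x ⟩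
  u ++ w ++ q                           ≡⟨ ++-assoc u w q ⟨
  (u ++ w) ++ q                         ∎
  where open ≈-Reasoning

++-cong : {u u′ v v′ : Word V} → u ≈ u′ → v ≈ v′ → u ++ v ≈ u′ ++ v′
++-cong {u′ = u′} {v = v} e e′ = ≈-trans (++-congʳ v e) (++-congˡ u′ e′)

-ₑ-inverseʳ : (u : Word V) → u ++ -ₑ u ≈ []
-ₑ-inverseʳ [] = ≈-refl
-ₑ-inverseʳ (l ∷ u) = begin
  l ∷ u ++ -ₑ (l ∷ u)            ≡⟨ cong (λ z → l ∷ u ++ z) (-ₑ-∷ l u) ⟩
  l ∷ u ++ -ₑ u ++ inv l ∷ []   ≡⟨ cong (l ∷_) (++-assoc u (-ₑ u) _) ⟨
  l ∷ (u ++ -ₑ u) ++ inv l ∷ [] ≈⟨ ++-congˡ (l ∷ []) (++-congʳ (inv l ∷ []) (-ₑ-inverseʳ u)) ⟩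
  l ∷ inv l ∷ []                ≈⟨ inv-cancel [] [] l ⟩
  []                            ∎
  where open ≈-Reasoning

≈[]⇒-ₑ≈[] : u ≈ [] → -ₑ u ≈ []
≈[]⇒-ₑ≈[] {u = u} e = ≈-trans (≈-sym (++-congʳ (-ₑ u) e)) (-ₑ-inverseʳ u)

-ₑ≈[]⇒≈[] : -ₑ u ≈ [] → u ≈ []
-ₑ≈[]⇒≈[] {u = u} e = begin
  u          ≡⟨ ++-identityʳ u ⟨
  u ++ []    ≈⟨ ++-congˡ u e ⟨
  u ++ -ₑ u  ≈⟨ -ₑ-inverseʳ u ⟩
  []         ∎
  where open ≈-Reasoning

commutator-≈[]ˡ : u ≈ [] → [ u , v ]ₑ ≈ []
commutator-≈[]ˡ {u = u} {v = v} u≈[] = begin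
  ((u ++ v) ++ -ₑ u) ++ -ₑ v ≈⟨ ++-congʳ (-ₑ v) (++-cong (++-congʳ v u≈[]) (≈[]⇒-ₑ≈[] u≈[])) ⟩
  (v ++ []) ++ -ₑ v          ≡⟨ cong (_++ -ₑ v) (++-identityʳ v) ⟩
  v ++ -ₑ v                  ≈⟨ -ₑ-inverseʳ v ⟩
  []                         ∎
  where open ≈-Reasoning

commutator-≈[]ʳ : v ≈ [] → [ u , v ]ₑ ≈ []
commutator-≈[]ʳ {v = v} {u = u} v≈[] = begin
  ((u ++ v) ++ -ₑ u) ++ -ₑ v ≈⟨ ++-cong (++-congʳ (-ₑ u) (++-congˡ u v≈[])) (≈[]⇒-ₑ≈[] v≈[]) ⟩
  ((u ++ []) ++ -ₑ u) ++ []  ≡⟨ ++-identityʳ _ ⟩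
  (u ++ []) ++ -ₑ u          ≡⟨ cong (_++ -ₑ u) (++-identityʳ u) ⟩
  u ++ -ₑ u                  ≈⟨ -ₑ-inverseʳ u ⟩
  []                         ∎
  where open ≈-Reasoning

-- embed₁ and embed₂ are definitionally rename inj₁ and rename inj₂.
rename : (V → W) → Word V → Word W
rename g = map (map₂ g)

rename-cong : (g : V → W) → u ≈ v → rename g u ≈ rename g v
rename-cong g ≈-refl = ≈-refl
rename-cong g (≈-sym e) = ≈-sym (rename-cong g e)
rename-cong g (≈-trans e e′) = ≈-trans (rename-cong g e) (rename-cong g e′)
rename-cong g (≈-cancel u w b x) = begin
  rename g (u ++ (b , x) ∷ (not b , x) ∷ w) ≡⟨ map-++ _ u _ ⟩
  rename g u ++ (b , g x) ∷ (not b , g x) ∷ rename g w ≈⟨ ≈-cancel _ _ b (g x) ⟩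
  rename g u ++ rename g w                  ≡⟨ map-++ _ u w ⟨
  rename g (u ++ w)                         ∎
  where open ≈-Reasoning

rename-neg : (g : V → W) (u : Word V) → rename g (-ₑ u) ≡ -ₑ (rename g u)
rename-neg g u = begin
  rename g (reverse (map inv u))   ≡⟨ reverse-map (map₂ g) (map inv u) ⟩
  reverse (rename g (map inv u))   ≡⟨ cong reverse (map-∘ u) ⟨
  reverse (map (inv ∘ map₂ g) u)   ≡⟨ cong reverse (map-∘ u) ⟩
  reverse (map inv (rename g u))   ∎
  where open ≡-Reasoning

restrict-++ : (u w : Word V) (S : Subset V) → restrict (u ++ w) S ≡ restrict u S ++ restrict w S
restrict-++ u w S = concatMap-++ _ u w

restrict-neg : (u : Word V) (S : Subset V) → restrict (-ₑ u) S ≡ -ₑ (restrict u S)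
restrict-neg [] S = refl
restrict-neg (l ∷ u) S
  rewrite -ₑ-∷ l u | restrict-++ (-ₑ u) (inv l ∷ []) S | restrict-neg u S
  with S (proj₂ l)
... | true = ++-identityʳ _
... | false = sym (-ₑ-∷ l (restrict u S))

restrict-commutator : (u v : Word V) (S : Subset V) →
  restrict [ u , v ]ₑ S ≡ [ restrict u S , restrict v S ]ₑ
restrict-commutator u v S
  rewrite restrict-++ ((u ++ v) ++ -ₑ u) (-ₑ v) S | restrict-++ (u ++ v) (-ₑ u) S
        | restrict-++ u v S | restrict-neg u S | restrict-neg v S = refl

restrict-rename : (g : V → W) (u : Word V) (S : Subset W) →
  restrict (rename g u) S ≡ rename g (restrict u (S ∘ g))
restrict-rename g [] S = refl
restrict-rename g ((b , x) ∷ u) S with S (g x)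
... | true = restrict-rename g u S
... | false = cong ((b , g x) ∷_) (restrict-rename g u S)

data Reduced {V : Set} : Word V → Set where
  []  : Reduced []
  [_] : ∀ l → Reduced (l ∷ [])
  _∷_ : l′ ≢ inv l → Reduced (l′ ∷ w) → Reduced (l ∷ l′ ∷ w)

reduced-tail : Reduced (l ∷ w) → Reduced w
reduced-tail [ l ] = []
reduced-tail (_ ∷ r) = r

rename-reduced : {g : V → W} → Injective _≡_ _≡_ g → Reduced u → Reduced (rename g u)
rename-reduced g-inj [] = []
rename-reduced g-inj [ l ] = [ _ ]
rename-reduced g-inj (l′≢l⁻¹ ∷ r) =
  (λ e → l′≢l⁻¹ (Product.×-≡,≡→≡ (cong proj₁ e , g-inj (cong proj₂ e)))) ∷ rename-reduced g-inj r

++-reduced : (P : V → Set) → All (P ∘ proj₂) u → ¬ P (proj₂ l′) →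
  Reduced u → Reduced (l′ ∷ w) → Reduced (u ++ l′ ∷ w)
++-reduced P _ _ [] r′ = r′
++-reduced P (p ∷ []) ¬p′ [ l ] r′ = (λ e → ¬p′ (subst P (sym (cong proj₂ e)) p)) ∷ r′
++-reduced P (_ ∷ ps) ¬p′ (l′≢l⁻¹ ∷ r) r′ = l′≢l⁻¹ ∷ ++-reduced P ps ¬p′ r r′

All-rename : (P : W → Set) {g : V → W} → (∀ x → P (g x)) → (u : Word V) → All (P ∘ proj₂) (rename g u)
All-rename P p [] = []
All-rename P p (l ∷ u) = p (proj₂ l) ∷ All-rename P p u

Nontrivial : Word V → Set
Nontrivial {V} w = ∃₂ λ (l : Letter V) ws → Reduced (l ∷ ws) × w ≈ l ∷ ws

rename-nontrivial : {g : V → W} → Injective _≡_ _≡_ g → Nontrivial u → Nontrivial (rename g u)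
rename-nontrivial {g = g} g-inj (l , ws , r , u≈) = _ , _ , rename-reduced g-inj r , rename-cong g u≈

module NormalForm {V : Set} (_≟_ : DecidableEquality V) where

  _≟ₗ_ : DecidableEquality (Letter V)
  _≟ₗ_ = Product.≡-dec Bool._≟_ _≟_

  push : Letter V → Word V → Word V
  push l [] = l ∷ []
  push l (l′ ∷ w) with l′ ≟ₗ inv l
  ... | yes _ = w
  ... | no _ = l ∷ l′ ∷ w

  nf : Word V → Word V
  nf = foldr push []

  push-reduced : ∀ l → Reduced w → Reduced (push l w)
  push-reduced l [] = [ l ]
  push-reduced l [ l′ ] with l′ ≟ₗ inv l
  ... | yes _ = []
  ... | no l′≢l⁻¹ = l′≢l⁻¹ ∷ [ l′ ]
  push-reduced l (_∷_ {l = l′} l″≢l′⁻¹ r) with l′ ≟ₗ inv l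
  ... | yes _ = r
  ... | no l′≢l⁻¹ = l′≢l⁻¹ ∷ l″≢l′⁻¹ ∷ r

  nf-reduced : (w : Word V) → Reduced (nf w)
  nf-reduced [] = []
  nf-reduced (l ∷ w) = push-reduced l (nf-reduced w)

  push-cancel : (l : Letter V) (w : Word V) → push l (inv l ∷ w) ≡ w
  push-cancel l w with inv l ≟ₗ inv l
  ... | yes _ = refl
  ... | no ¬refl = ⊥-elim (¬refl refl)

  push-reduced-∷ : Reduced (l ∷ w) → push l w ≡ l ∷ w
  push-reduced-∷ [ l ] = refl
  push-reduced-∷ {l = l} (_∷_ {l′ = l′} l′≢l⁻¹ _) with l′ ≟ₗ inv l
  ... | yes l′≡l⁻¹ = ⊥-elim (l′≢l⁻¹ l′≡l⁻¹)
  ... | no _ = refl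

  push-push-inv-∷ : ∀ l → Reduced (l′ ∷ w) → push l (push (inv l) (l′ ∷ w)) ≡ l′ ∷ w
  push-push-inv-∷ {l′ = l′} {w = w} l r with l′ ≟ₗ inv (inv l)
  ... | no _ = push-cancel l (l′ ∷ w)
  ... | yes l′≡l⁻¹⁻¹ with trans l′≡l⁻¹⁻¹ (inv-involutive l)
  ...   | refl = push-reduced-∷ r

  push-push-inv : ∀ l → Reduced w → push l (push (inv l) w) ≡ w
  push-push-inv l [] = push-cancel l []
  push-push-inv l r@([ _ ]) = push-push-inv-∷ l r
  push-push-inv l r@(_ ∷ _) = push-push-inv-∷ l r

  nf-reduced-id : Reduced w → nf w ≡ w
  nf-reduced-id [] = refl
  nf-reduced-id {w = l ∷ w} r = trans (cong (push l) (nf-reduced-id (reduced-tail r))) (push-reduced-∷ r)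

  nf-cong : u ≈ v → nf u ≡ nf v
  nf-cong ≈-refl = refl
  nf-cong (≈-sym e) = sym (nf-cong e)
  nf-cong (≈-trans e e′) = trans (nf-cong e) (nf-cong e′)
  nf-cong (≈-cancel u w b x) = begin
    foldr push [] (u ++ (b , x) ∷ (not b , x) ∷ w)     ≡⟨ foldr-++ push [] u _ ⟩
    foldr push (push (b , x) (push (not b , x) (nf w))) u ≡⟨ cong (λ z → foldr push z u) (push-push-inv (b , x) (nf-reduced w)) ⟩
    foldr push (nf w) u                                ≡⟨ foldr-++ push [] u w ⟨
    foldr push [] (u ++ w)                             ∎
    where open ≡-Reasoning

  push-≈ : (l : Letter V) (w : Word V) → l ∷ w ≈ push l w
  push-≈ l [] = ≈-refl
  push-≈ l (l′ ∷ w) with l′ ≟ₗ inv l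
  ... | yes refl = inv-cancel [] w l
  ... | no _ = ≈-refl

  ≈-nf : (w : Word V) → w ≈ nf w
  ≈-nf [] = ≈-refl
  ≈-nf (l ∷ w) = ≈-trans (++-congˡ (l ∷ []) (≈-nf w)) (push-≈ l (nf w))

  ≈[]-or-nontrivial : (w : Word V) → w ≈ [] ⊎ Nontrivial w
  ≈[]-or-nontrivial w with nf w | nf-reduced w | ≈-nf w
  ... | [] | _ | w≈[] = inj₁ w≈[]
  ... | l ∷ ws | r | w≈ = inj₂ (l , ws , r , w≈)

  nontrivial-≉[] : {w : Word V} → Nontrivial w → ¬ w ≈ []
  nontrivial-≉[] (l , ws , r , w≈) w≈[] with trans (sym (nf-reduced-id r)) (nf-cong (≈-trans (≈-sym w≈) w≈[]))
  ... | ()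

  -ₑ-nontrivial : {w : Word V} → Nontrivial w → Nontrivial (-ₑ w)
  -ₑ-nontrivial {w = w} n with ≈[]-or-nontrivial (-ₑ w)
  ... | inj₁ -w≈[] = ⊥-elim (nontrivial-≉[] n (-ₑ≈[]⇒≈[] -w≈[]))
  ... | inj₂ n⁻ = n⁻

rename-≈[] : DecidableEquality V → DecidableEquality W →
  {g : V → W} → Injective _≡_ _≡_ g → rename g u ≈ [] → u ≈ []
rename-≈[] {u = u} _≟ⱽ_ _≟ᵂ_ g-inj e with NormalForm.≈[]-or-nontrivial _≟ⱽ_ u
... | inj₁ u≈[] = u≈[]
... | inj₂ n = ⊥-elim (NormalForm.nontrivial-≉[] _≟ᵂ_ (rename-nontrivial g-inj n) e)

⊓ₒ≡fall⇔ : (x y : Outcome) → (x ⊓ₒ y ≡ fall) ⇔ (x ≡ fall × y ≡ fall)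
⊓ₒ≡fall⇔ x y = mk⇔ (to x y) λ { (refl , refl) → refl }
  where
  to : ∀ x y → x ⊓ₒ y ≡ fall → x ≡ fall × y ≡ fall
  to fall fall refl = refl , refl

⊔ₒ≡fall⇔ : (x y : Outcome) → (x ⊔ₒ y ≡ fall) ⇔ (x ≡ fall ⊎ y ≡ fall)
⊔ₒ≡fall⇔ x y = mk⇔ (to x y) (from x y)
  where
  to : ∀ x y → x ⊔ₒ y ≡ fall → x ≡ fall ⊎ y ≡ fall
  to fall _ _ = inj₁ refl
  to hang _ y≡fall = inj₂ y≡fall
  from : ∀ x y → x ≡ fall ⊎ y ≡ fall → x ⊔ₒ y ≡ fall
  from fall _ _ = refl
  from hang _ (inj₂ y≡fall) = y≡fall

module Disjoint {A B : Set} (_≟ᴬ_ : DecidableEquality A) (_≟ᴮ_ : DecidableEquality B) where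

  private
    module NA = NormalForm _≟ᴬ_
    module NB = NormalForm _≟ᴮ_
    _≟_ : DecidableEquality (A ⊎ B)
    _≟_ = Sum.≡-dec _≟ᴬ_ _≟ᴮ_

    isInj₁ : A ⊎ B → Bool
    isInj₁ = [ (λ _ → true) , (λ _ → false) ]′

    FromA FromB : A ⊎ B → Set
    FromA x = isInj₁ x ≡ true
    FromB x = isInj₁ x ≡ false

  embed-+-≉[] : {a : Word A} {b : Word B} → Nontrivial a → Nontrivial b →
    ¬ embed₁ a +ₑ embed₂ b ≈ []
  embed-+-≉[] (l , as , ra , a≈) (m , bs , rb , b≈) = NormalForm.nontrivial-≉[] _≟_
    ( _ , _
    , ++-reduced FromA (All-rename FromA (λ _ → refl) (l ∷ as)) (λ ())
        (rename-reduced Sum.inj₁-injective ra) (rename-reduced Sum.inj₂-injective rb)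
    , ++-cong (rename-cong inj₁ a≈) (rename-cong inj₂ b≈))

  embed-commutator-≉[] : {a : Word A} {b : Word B} → Nontrivial a → Nontrivial b →
    ¬ [ embed₁ a , embed₂ b ]ₑ ≈ []
  embed-commutator-≉[] {a} {b} na@(l , as , ra , a≈) nb@(m , bs , rb , b≈)
    with NA.-ₑ-nontrivial na | NB.-ₑ-nontrivial nb
  ... | (l′ , as′ , ra′ , a′≈) | (m′ , bs′ , rb′ , b′≈) =
    NormalForm.nontrivial-≉[] _≟_ (_ , _ , alternating , ≈alternating)
    where
    alternating : Reduced (embed₁ (l ∷ as) ++ embed₂ (m ∷ bs) ++ embed₁ (l′ ∷ as′) ++ embed₂ (m′ ∷ bs′))
    alternating =
      ++-reduced FromA (All-rename FromA (λ _ → refl) (l ∷ as)) (λ ()) (rename-reduced Sum.inj₁-injective ra)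
        (++-reduced FromB (All-rename FromB (λ _ → refl) (m ∷ bs)) (λ ()) (rename-reduced Sum.inj₂-injective rb)
          (++-reduced FromA (All-rename FromA (λ _ → refl) (l′ ∷ as′)) (λ ()) (rename-reduced Sum.inj₁-injective ra′)
            (rename-reduced Sum.inj₂-injective rb′)))
    ≈alternating : [ embed₁ a , embed₂ b ]ₑ ≈ embed₁ (l ∷ as) ++ embed₂ (m ∷ bs) ++ embed₁ (l′ ∷ as′) ++ embed₂ (m′ ∷ bs′)
    ≈alternating = begin
      ((embed₁ a ++ embed₂ b) ++ -ₑ embed₁ a) ++ -ₑ embed₂ b
        ≡⟨ cong₂ (λ p q → ((embed₁ a ++ embed₂ b) ++ p) ++ q) (rename-neg inj₁ a) (rename-neg inj₂ b) ⟨
      ((embed₁ a ++ embed₂ b) ++ embed₁ (-ₑ a)) ++ embed₂ (-ₑ b)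
        ≈⟨ ++-cong (++-cong (++-cong (rename-cong inj₁ a≈) (rename-cong inj₂ b≈)) (rename-cong inj₁ a′≈))
                   (rename-cong inj₂ b′≈) ⟩
      ((embed₁ (l ∷ as) ++ embed₂ (m ∷ bs)) ++ embed₁ (l′ ∷ as′)) ++ embed₂ (m′ ∷ bs′)
        ≡⟨ ++-assoc (embed₁ (l ∷ as) ++ embed₂ (m ∷ bs)) _ _ ⟩
      (embed₁ (l ∷ as) ++ embed₂ (m ∷ bs)) ++ embed₁ (l′ ∷ as′) ++ embed₂ (m′ ∷ bs′)
        ≡⟨ ++-assoc (embed₁ (l ∷ as)) _ _ ⟩
      embed₁ (l ∷ as) ++ embed₂ (m ∷ bs) ++ embed₁ (l′ ∷ as′) ++ embed₂ (m′ ∷ bs′) ∎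
      where open ≈-Reasoning

  embed-+-≈[]⇔ : (a : Word A) (b : Word B) → (embed₁ a +ₑ embed₂ b ≈ 0ₑ) ⇔ (a ≈ 0ₑ × b ≈ 0ₑ)
  embed-+-≈[]⇔ a b = mk⇔ to λ (a≈[] , b≈[]) → ++-cong (rename-cong inj₁ a≈[]) (rename-cong inj₂ b≈[])
    where
    to : embed₁ a +ₑ embed₂ b ≈ [] → a ≈ [] × b ≈ []
    to e with NA.≈[]-or-nontrivial a | NB.≈[]-or-nontrivial b
    ... | inj₁ a≈[] | _ =
      a≈[] , rename-≈[] _≟ᴮ_ _≟_ Sum.inj₂-injective (≈-trans (≈-sym (++-congʳ _ (rename-cong inj₁ a≈[]))) e)
    ... | inj₂ _ | inj₁ b≈[] =
      rename-≈[] _≟ᴬ_ _≟_ Sum.inj₁-injective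
        (≈-trans (≡⇒≈ (sym (++-identityʳ _))) (≈-trans (≈-sym (++-congˡ _ (rename-cong inj₂ b≈[]))) e))
      , b≈[]
    ... | inj₂ na | inj₂ nb = ⊥-elim (embed-+-≉[] na nb e)

  embed-commutator-≈[]⇔ : (a : Word A) (b : Word B) → ([ embed₁ a , embed₂ b ]ₑ ≈ 0ₑ) ⇔ (a ≈ 0ₑ ⊎ b ≈ 0ₑ)
  embed-commutator-≈[]⇔ a b = mk⇔ to from
    where
    to : [ embed₁ a , embed₂ b ]ₑ ≈ [] → a ≈ [] ⊎ b ≈ []
    to e with NA.≈[]-or-nontrivial a | NB.≈[]-or-nontrivial b
    ... | inj₁ a≈[] | _ = inj₁ a≈[]
    ... | inj₂ _ | inj₁ b≈[] = inj₂ b≈[]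
    ... | inj₂ na | inj₂ nb = ⊥-elim (embed-commutator-≉[] na nb e)
    from : a ≈ [] ⊎ b ≈ [] → [ embed₁ a , embed₂ b ]ₑ ≈ []
    from (inj₁ a≈[]) = commutator-≈[]ˡ {v = embed₂ b} (rename-cong inj₁ a≈[])
    from (inj₂ b≈[]) = commutator-≈[]ʳ {u = embed₁ a} (rename-cong inj₂ b≈[])

  module _ (h₁ : Word A) (h₂ : Word B) {f₁ : Subset A → Outcome} {f₂ : Subset B → Outcome}
           (s₁ : Solves h₁ f₁) (s₂ : Solves h₂ f₂) where

    solves-+ : Solves (embed₁ h₁ +ₑ embed₂ h₂) ((λ S → f₁ (S ∘ inj₁)) ∧ₛ (λ S → f₂ (S ∘ inj₂)))
    solves-+ S = subst (λ w → (w ≈ 0ₑ) ⇔ _) (sym restrict≡)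
      (⇔.trans (embed-+-≈[]⇔ _ _) (⇔.trans (s₁ (S ∘ inj₁) ×-⇔ s₂ (S ∘ inj₂)) (⇔.sym (⊓ₒ≡fall⇔ _ _))))
      where
      restrict≡ : restrict (embed₁ h₁ +ₑ embed₂ h₂) S
                ≡ embed₁ (restrict h₁ (S ∘ inj₁)) +ₑ embed₂ (restrict h₂ (S ∘ inj₂))
      restrict≡ = trans (restrict-++ (embed₁ h₁) (embed₂ h₂) S)
                        (cong₂ _++_ (restrict-rename inj₁ h₁ S) (restrict-rename inj₂ h₂ S))

    solves-commutator : Solves [ embed₁ h₁ , embed₂ h₂ ]ₑ ((λ S → f₁ (S ∘ inj₁)) ∨ₛ (λ S → f₂ (S ∘ inj₂)))
    solves-commutator S = subst (λ w → (w ≈ 0ₑ) ⇔ _) (sym restrict≡)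
      (⇔.trans (embed-commutator-≈[]⇔ _ _) (⇔.trans (s₁ (S ∘ inj₁) ⊎-⇔ s₂ (S ∘ inj₂)) (⇔.sym (⊔ₒ≡fall⇔ _ _))))
      where
      restrict≡ : restrict [ embed₁ h₁ , embed₂ h₂ ]ₑ S
                ≡ [ embed₁ (restrict h₁ (S ∘ inj₁)) , embed₂ (restrict h₂ (S ∘ inj₂)) ]ₑ
      restrict≡ = trans (restrict-commutator (embed₁ h₁) (embed₂ h₂) S)
                        (cong₂ [_,_]ₑ (restrict-rename inj₁ h₁ S) (restrict-rename inj₂ h₂ S))

lemma3p1 : (m n : ℕ) (f₁ : Specification (Fin m)) (h₁ : Word (Fin m))
    (f₂ : Specification (Fin n)) (h₂ : Word (Fin n)) →
    Solves h₁ (spec f₁) → Solves h₂ (spec f₂) →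
    Solves {Fin m ⊎ Fin n} (embed₁ h₁ +ₑ embed₂ h₂) (lift₁ f₁ ∧ₛ lift₂ f₂)
    × Solves {Fin m ⊎ Fin n} [ embed₁ h₁ , embed₂ h₂ ]ₑ (lift₁ f₁ ∨ₛ lift₂ f₂)
lemma3p1 m n f₁ h₁ f₂ h₂ s₁ s₂ = solves-+ h₁ h₂ s₁ s₂ , solves-commutator h₁ h₂ s₁ s₂
  where open Disjoint Fin._≟_ Fin._≟_
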